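{- A configuration $\mathcal C=(V,\mathcal I,\mathcal D)$ is irreducible if and only if it is connected.
   Context: A configuration is a triple $(V,\mathcal I,\mathcal D)$ where $V$ is a finite set, $\mathcal I\subseteq\mathcal P(V)$ is non empty, downward closed under inclusion and contains every singleton, and $\mathcal D=\mathcal P(V)\setminus\mathcal I$. A pair $(V_1,V_2)$ of subsets of $V$ with $V_1\cap V_2=\emptyset$, $V_1\cup V_2=V$ is a decomposition if for every $x\subseteq V$: $x\in\mathcal I$ iff ($x\cap V_1\in\mathcal I$ and $x\cap V_2\in\mathcal I$); it is trivial if $V_1=\emptyset$ or $V_2=\emptyset$. The configuration is reducible if it has a non trivial decomposition, irreducible otherwise. The nubs are the inclusion-minimal elements of $\mathcal D$; a nub path from $a$ to $b$ is a finite non empty sequence of nubs $x_1,\dots,x_k$ with $a\in x_1$, $b\in x_k$, $x_i\cap x_{i+1}\ne\emptyset$. The configuration is connected if for any two distinct vertices $a,b\in V$ there is a nub path from $a$ to $b$. -}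

module Defs where

open import Data.Nat using (ℕ)
open import Data.Bool using (Bool; true; false)
open import Data.Fin using (Fin)
open import Data.Fin.Subset using (Subset; _∈_; _⊆_; _⊂_; _∩_; _∪_; ⊥; ⊤; ⁅_⁆; Nonempty)
open import Data.Product using (Σ; ∃; _×_; _,_)
open import Relation.Binary.PropositionalEquality using (_≡_; _≢_)
open import Relation.Nullary using (¬_)
open import Function.Bundles using (_⇔_)

-- The vertex set V is Fin n.  A family 𝓘 ⊆ 𝒫(V) of subsets of a finite set
-- is given by its (boolean) characteristic function.
Family : ℕ → Set
Family n = Subset n → Bool

_∈𝓘_ : ∀ {n} → Subset n → Family n → Set
x ∈𝓘 I = I x ≡ true

_∈𝓓_ : ∀ {n} → Subset n → Family n → Set
x ∈𝓓 I = ¬ (x ∈𝓘 I)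

record IsConfiguration {n : ℕ} (I : Family n) : Set where
  field
    nonempty       : ∃ λ x → x ∈𝓘 I
    downwardClosed : ∀ x y → y ⊆ x → x ∈𝓘 I → y ∈𝓘 I
    singletons     : ∀ (v : Fin n) → ⁅ v ⁆ ∈𝓘 I

IsDecomposition : ∀ {n} → Family n → Subset n → Subset n → Set
IsDecomposition I V₁ V₂ =
  (V₁ ∩ V₂ ≡ ⊥) × (V₁ ∪ V₂ ≡ ⊤) ×
  (∀ x → (x ∈𝓘 I) ⇔ ((x ∩ V₁) ∈𝓘 I × (x ∩ V₂) ∈𝓘 I))

NonTrivial : ∀ {n} → Subset n → Subset n → Set
NonTrivial V₁ V₂ = (V₁ ≢ ⊥) × (V₂ ≢ ⊥)

Reducible : ∀ {n} → Family n → Set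
Reducible {n} I = ∃ λ (V₁ : Subset n) → ∃ λ (V₂ : Subset n) →
  IsDecomposition I V₁ V₂ × NonTrivial V₁ V₂

Irreducible : ∀ {n} → Family n → Set
Irreducible I = ¬ Reducible I

IsNub : ∀ {n} → Family n → Subset n → Set
IsNub I x = x ∈𝓓 I × (∀ y → y ⊂ x → ¬ (y ∈𝓓 I))

-- A nub path from a to b: a non-empty sequence of nubs x₁,…,x_k with
-- a ∈ x₁, b ∈ x_k and consecutive nubs intersecting.  Encoded inductively:
-- `one` is the length-1 sequence, `step x c p` prepends the nub x to the
-- path p (from c), where c ∈ x witnesses x ∩ (first nub of p) ≠ ∅.
data NubPath {n : ℕ} (I : Family n) : Fin n → Fin n → Set where
  one  : ∀ {a b} (x : Subset n) → IsNub I x → a ∈ x → b ∈ x → NubPath I a b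
  step : ∀ {a b} (x : Subset n) → IsNub I x → a ∈ x →
         (c : Fin n) → c ∈ x → NubPath I c b → NubPath I a b

Connected : ∀ {n} → Family n → Set
Connected {n} I = ∀ (a b : Fin n) → a ≢ b → NubPath I a b

-- A decomposition (V₁ , V₂) cannot separate two vertices of a nub x: otherwise
-- x ∩ V₁ and x ∩ V₂ are proper subsets of x, hence independent, forcing x to be
-- independent.  So nub paths never cross a decomposition, and a connected
-- configuration is irreducible.  Conversely, the set T of vertices reachable
-- from a by nub paths contains every nub it meets; then a dependent x contains a
-- nub lying inside T or inside ∁ T, so (T , ∁ T) is a decomposition, which by
-- irreducibility is trivial, i.e. T is everything.
module Submission where

open import Defs
open import Data.Nat using (ℕ)
open import Data.Bool using (true) renaming (_≟_ to _≟ᵇ_)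
open import Data.Fin using (Fin; _≟_)
open import Data.Fin.Properties using (any?)
open import Data.Fin.Subset
open import Data.Fin.Subset.Properties
open import Data.Fin.Subset.Induction using (Acc; acc; ⊂-wellFounded; ⊃-wellFounded)
open import Data.Empty using (⊥-elim)
open import Data.Product using (∃; _×_; _,_; proj₁; proj₂)
open import Data.Sum using (_⊎_; inj₁; inj₂)
open import Function.Bundles using (_⇔_; mk⇔; Equivalence)
open import Level using (Level)
open import Relation.Binary using (Rel; Decidable)
open import Relation.Binary.Construct.Closure.ReflexiveTransitive using (Star; ε; _◅_; _◅◅_)
open import Relation.Binary.PropositionalEquality using (_≡_; _≢_; refl; sym; subst)
open import Relation.Nullary using (¬_; Dec; yes; no; ¬?)
open import Relation.Nullary.Decidable using (_×-dec_; map′; decidable-stable)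

module _ {n : ℕ} where

  ∩≡⊥⇒disjoint : ∀ {p q : Subset n} {x} → p ∩ q ≡ ⊥ → x ∈ p → x ∉ q
  ∩≡⊥⇒disjoint {p} {q} {x} p∩q≡⊥ x∈p x∈q = ∉⊥ (subst (x ∈_) p∩q≡⊥ (x∈p∩q⁺ (x∈p , x∈q)))

  ∪≡⊤⇒covering : ∀ {p q : Subset n} x → p ∪ q ≡ ⊤ → x ∈ p ⊎ x ∈ q
  ∪≡⊤⇒covering {p} {q} x p∪q≡⊤ = x∈p∪q⁻ p q (subst (x ∈_) (sym p∪q≡⊤) ∈⊤)

  ⊆-∩ : ∀ {p q r : Subset n} → p ⊆ q → p ⊆ r → p ⊆ q ∩ r
  ⊆-∩ p⊆q p⊆r x∈p = x∈p∩q⁺ (p⊆q x∈p , p⊆r x∈p)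

  ∈⇒≢⊥ : ∀ {p : Subset n} {x} → x ∈ p → p ≢ ⊥
  ∈⇒≢⊥ {x = x} x∈p p≡⊥ = ∉⊥ (subst (x ∈_) p≡⊥ x∈p)

  ≢⊥⇒Nonempty : ∀ {p : Subset n} → p ≢ ⊥ → Nonempty p
  ≢⊥⇒Nonempty {p} p≢⊥ with nonempty? p
  ... | yes ne = ne
  ... | no  ¬ne = ⊥-elim (p≢⊥ (Empty-unique ¬ne))

module Reachability {n : ℕ} {ℓ : Level} {R : Rel (Fin n) ℓ} (R? : Decidable R) where

  ClosedUnder : Subset n → Set ℓ
  ClosedUnder S = ∀ {d c} → d ∈ S → R d c → c ∈ S

  ReachableFrom : Fin n → Subset n → Set ℓ
  ReachableFrom a S = ∀ {c} → c ∈ S → Star R a c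

  closure : ∀ a → ∃ λ T → a ∈ T × ClosedUnder T × ReachableFrom a T
  closure a = grow ⁅ a ⁆ (⊃-wellFounded ⁅ a ⁆) (x∈⁅x⁆ a) reach-⁅a⁆
    where
    reach-⁅a⁆ : ReachableFrom a ⁅ a ⁆
    reach-⁅a⁆ c∈⁅a⁆ = subst (Star R a) (sym (x∈⁅y⁆⇒x≡y a c∈⁅a⁆)) ε

    grow : ∀ S → Acc _⊃_ S → a ∈ S → ReachableFrom a S →
           ∃ λ T → a ∈ T × ClosedUnder T × ReachableFrom a T
    grow S (acc rec) a∈S reach
      with any? (λ d → any? (λ c → d ∈? S ×-dec R? d c ×-dec ¬? (c ∈? S)))
    ... | no noExit = S , a∈S , closed , reach
      where
      closed : ClosedUnder S
      closed {d} {c} d∈S dRc with c ∈? S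
      ... | yes c∈S = c∈S
      ... | no  c∉S = ⊥-elim (noExit (d , c , d∈S , dRc , c∉S))
    ... | yes (d , c , d∈S , dRc , c∉S) =
      grow (S ∪ ⁅ c ⁆) (rec S∪c⊃S) (p⊆p∪q ⁅ c ⁆ a∈S) reach′
      where
      S∪c⊃S : (S ∪ ⁅ c ⁆) ⊃ S
      S∪c⊃S = p⊆p∪q ⁅ c ⁆ , c , x∈p∪q⁺ (inj₂ (x∈⁅x⁆ c)) , c∉S

      reach′ : ReachableFrom a (S ∪ ⁅ c ⁆)
      reach′ {e} e∈S∪c with x∈p∪q⁻ S ⁅ c ⁆ e∈S∪c
      ... | inj₁ e∈S = reach e∈S
      ... | inj₂ e∈c = subst (Star R a) (sym (x∈⁅y⁆⇒x≡y c e∈c)) (reach d∈S ◅◅ (dRc ◅ ε))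

module Nubs {n : ℕ} (I : Family n) where

  DownwardClosed : Set
  DownwardClosed = ∀ x y → y ⊆ x → x ∈𝓘 I → y ∈𝓘 I

  _∈𝓘? : ∀ x → Dec (x ∈𝓘 I)
  x ∈𝓘? = I x ≟ᵇ true

  ProperDependentSubset : Subset n → Set
  ProperDependentSubset x = ∃ λ y → y ⊂ x × y ∈𝓓 I

  properDependentSubset? : ∀ x → Dec (ProperDependentSubset x)
  properDependentSubset? x = anySubset? (λ y → y ⊂? x ×-dec ¬? (y ∈𝓘?))

  minimal⇒IsNub : ∀ {x} → x ∈𝓓 I → ¬ ProperDependentSubset x → IsNub I x
  minimal⇒IsNub x∈𝓓 minimal = x∈𝓓 , λ y y⊂x y∈𝓓 → minimal (y , y⊂x , y∈𝓓)

  isNub? : ∀ x → Dec (IsNub I x)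
  isNub? x = map′ (λ (x∈𝓓 , minimal) → minimal⇒IsNub x∈𝓓 minimal)
                  (λ (x∈𝓓 , minimal) → x∈𝓓 , λ (y , y⊂x , y∈𝓓) → minimal y y⊂x y∈𝓓)
                  (¬? (x ∈𝓘?) ×-dec ¬? (properDependentSubset? x))

  proper⇒independent : ∀ {x y} → IsNub I x → y ⊂ x → y ∈𝓘 I
  proper⇒independent {y = y} (_ , minimal) y⊂x =
    decidable-stable (y ∈𝓘?) (minimal y y⊂x)

  dependent⇒nub⊆ : ∀ {x} → x ∈𝓓 I → ∃ λ y → y ⊆ x × IsNub I y
  dependent⇒nub⊆ {x} = go x (⊂-wellFounded x)
    where
    go : ∀ x → Acc _⊂_ x → x ∈𝓓 I → ∃ λ y → y ⊆ x × IsNub I y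
    go x (acc rec) x∈𝓓 with properDependentSubset? x
    ... | no  minimal = x , ⊆-refl , minimal⇒IsNub x∈𝓓 minimal
    ... | yes (y , y⊂x , y∈𝓓) with go y (rec y⊂x) y∈𝓓
    ...   | z , z⊆y , z-nub = z , ⊆-trans z⊆y (p⊂q⇒p⊆q y⊂x) , z-nub

  Adjacent : Rel (Fin n) _
  Adjacent d c = ∃ λ y → IsNub I y × d ∈ y × c ∈ y

  adjacent? : Decidable Adjacent
  adjacent? d c = anySubset? (λ y → isNub? y ×-dec d ∈? y ×-dec c ∈? y)

  open Reachability adjacent? using (closure)

  star⇒NubPath : ∀ {a b} → Star Adjacent a b → a ≢ b → NubPath I a b
  star⇒NubPath ε a≢a = ⊥-elim (a≢a refl)
  star⇒NubPath {b = b} (_◅_ {j = c} (y , y-nub , a∈y , c∈y) path) a≢b with c ≟ b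
  ... | yes refl = one y y-nub a∈y c∈y
  ... | no  c≢b  = step y y-nub a∈y c c∈y (star⇒NubPath path c≢b)

  NoNubStraddles : Subset n → Subset n → Set
  NoNubStraddles V₁ V₂ = ∀ {x u w} → IsNub I x → u ∈ x → u ∈ V₁ → w ∈ x → w ∉ V₂

  decomposition⇒NoNubStraddles : ∀ {V₁ V₂} → IsDecomposition I V₁ V₂ → NoNubStraddles V₁ V₂
  decomposition⇒NoNubStraddles {V₁} {V₂} (V₁∩V₂≡⊥ , _ , splits) {x} {u} {w}
                               x-nub u∈x u∈V₁ w∈x w∈V₂ =
    proj₁ x-nub (Equivalence.from (splits x)
      ( proper⇒independent x-nub (p∩q⊆p x V₁ , w , w∈x , w∉x∩V₁)
      , proper⇒independent x-nub (p∩q⊆p x V₂ , u , u∈x , u∉x∩V₂)))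
    where
    w∉x∩V₁ : w ∉ x ∩ V₁
    w∉x∩V₁ w∈x∩V₁ = ∩≡⊥⇒disjoint V₁∩V₂≡⊥ (proj₂ (x∈p∩q⁻ x V₁ w∈x∩V₁)) w∈V₂

    u∉x∩V₂ : u ∉ x ∩ V₂
    u∉x∩V₂ u∈x∩V₂ = ∩≡⊥⇒disjoint V₁∩V₂≡⊥ u∈V₁ (proj₂ (x∈p∩q⁻ x V₂ u∈x∩V₂))

  nubPath-stays : ∀ {V₁ V₂ a b} → (∀ c → c ∈ V₁ ⊎ c ∈ V₂) → NoNubStraddles V₁ V₂ →
                  NubPath I a b → a ∈ V₁ → b ∉ V₂
  nubPath-stays cover noStraddle (one x x-nub a∈x b∈x) a∈V₁ b∈V₂ =
    noStraddle x-nub a∈x a∈V₁ b∈x b∈V₂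
  nubPath-stays cover noStraddle (step x x-nub a∈x c c∈x path) a∈V₁ with cover c
  ... | inj₁ c∈V₁ = nubPath-stays cover noStraddle path c∈V₁
  ... | inj₂ c∈V₂ = λ _ → noStraddle x-nub a∈x a∈V₁ c∈x c∈V₂

  nub⊆-side : ∀ {T x} → NoNubStraddles T (∁ T) → IsNub I x → x ⊆ T ⊎ x ⊆ ∁ T
  nub⊆-side {T} {x} noStraddle x-nub with any? (λ u → u ∈? x ×-dec u ∈? T)
  ... | yes (u , u∈x , u∈T) = inj₁ λ {w} w∈x → x∉∁p⇒x∈p (noStraddle x-nub u∈x u∈T w∈x)
  ... | no  disjoint = inj₂ λ {w} w∈x → x∉p⇒x∈∁p (λ w∈T → disjoint (w , w∈x , w∈T))

  NoNubStraddles⇒decomposition : DownwardClosed →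
    ∀ {T} → NoNubStraddles T (∁ T) → IsDecomposition I T (∁ T)
  NoNubStraddles⇒decomposition downwardClosed {T} noStraddle =
    ∩-inverseʳ T , p∪∁p≡⊤ T , λ x → mk⇔ (restrict x) (glue x)
    where
    restrict : ∀ x → x ∈𝓘 I → (x ∩ T) ∈𝓘 I × (x ∩ ∁ T) ∈𝓘 I
    restrict x x∈𝓘 = downwardClosed x _ (p∩q⊆p x T) x∈𝓘
                   , downwardClosed x _ (p∩q⊆p x (∁ T)) x∈𝓘

    glue : ∀ x → (x ∩ T) ∈𝓘 I × (x ∩ ∁ T) ∈𝓘 I → x ∈𝓘 I
    glue x (x∩T∈𝓘 , x∩∁T∈𝓘) =
      decidable-stable (x ∈𝓘?) (λ x∈𝓓 → no-nub⊆x (dependent⇒nub⊆ x∈𝓓))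
      where
      no-nub⊆x : ¬ (∃ λ y → y ⊆ x × IsNub I y)
      no-nub⊆x (y , y⊆x , y-nub) with nub⊆-side noStraddle y-nub
      ... | inj₁ y⊆T  = proj₁ y-nub (downwardClosed _ y (⊆-∩ y⊆x y⊆T) x∩T∈𝓘)
      ... | inj₂ y⊆∁T = proj₁ y-nub (downwardClosed _ y (⊆-∩ y⊆x y⊆∁T) x∩∁T∈𝓘)

  connected⇒irreducible : Connected I → Irreducible I
  connected⇒irreducible connected (V₁ , V₂ , D@(V₁∩V₂≡⊥ , V₁∪V₂≡⊤ , _) , V₁≢⊥ , V₂≢⊥)
    with ≢⊥⇒Nonempty V₁≢⊥ | ≢⊥⇒Nonempty V₂≢⊥
  ... | a , a∈V₁ | b , b∈V₂ =
    nubPath-stays (λ c → ∪≡⊤⇒covering c V₁∪V₂≡⊤) (decomposition⇒NoNubStraddles D)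
                  (connected a b a≢b) a∈V₁ b∈V₂
    where
    a≢b : a ≢ b
    a≢b refl = ∩≡⊥⇒disjoint V₁∩V₂≡⊥ a∈V₁ b∈V₂

  irreducible⇒connected : DownwardClosed → Irreducible I → Connected I
  irreducible⇒connected downwardClosed irreducible a b a≢b
    with closure a
  ... | T , a∈T , closed , reach with b ∈? T
  ...   | yes b∈T = star⇒NubPath (reach b∈T) a≢b
  ...   | no  b∉T = ⊥-elim (irreducible
          (T , ∁ T , NoNubStraddles⇒decomposition downwardClosed noStraddle ,
           ∈⇒≢⊥ a∈T , ∈⇒≢⊥ (x∉p⇒x∈∁p b∉T)))
    where
    noStraddle : NoNubStraddles T (∁ T)
    noStraddle x-nub u∈x u∈T w∈x w∈∁T = x∈∁p⇒x∉p w∈∁T (closed u∈T (_ , x-nub , u∈x , w∈x))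

proposition4 : ∀ (n : ℕ) (I : Family n) → IsConfiguration I →
    Irreducible I ⇔ Connected I
proposition4 n I configuration =
  mk⇔ (irreducible⇒connected (IsConfiguration.downwardClosed configuration))
      connected⇒irreducible
  where open Nubs I
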